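{- Let $p$ be a prime, $r$ a positive integer, $d = p^r$, and $f(x) = x(dx - 1) \in \mathbb{Z}[x]$. Then for every positive integer $n$, $D_f(n) \le p^{\lceil \log_p n \rceil}$.
   Context: For $f \in \mathbb{Z}[x]$ and $n \in \mathbb{Z}^{+}$, the discriminator $D_f(n)$ is the smallest positive integer $m$ such that $f(1), f(2), \ldots, f(n)$ are pairwise distinct modulo $m$; if no such $m$ exists, $D_f(n) = \infty$. -}

module Defs where

open import Data.Nat as ℕ using (ℕ; zero; suc; _^_; _≤_; _<_)
open import Data.Integer as ℤ using (ℤ; +_; _-_; _*_)
open import Data.Integer.Divisibility using (_∣_)
open import Data.Product using (_×_)
open import Relation.Nullary using (¬_)

fPoly : ℕ → ℤ → ℤ
fPoly d x = x * ((+ d) * x - + 1)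

DistinctMod : (ℤ → ℤ) → ℕ → ℕ → Set
DistinctMod f n m =
  ∀ (i j : ℕ) → 1 ≤ i → i < j → j ≤ n → ¬ ((+ m) ∣ (f (+ i) - f (+ j)))

IsDiscriminator : (ℤ → ℤ) → ℕ → ℕ → Set
IsDiscriminator f n D =
  (1 ≤ D) × DistinctMod f n D × (∀ m → 1 ≤ m → m < D → ¬ DistinctMod f n m)

-- k = ⌈log_b n⌉ (for n ≥ 1, b ≥ 2): k is the least natural number with n ≤ b^k.
IsCeilLog : ℕ → ℕ → ℕ → Set
IsCeilLog b n k = (n ≤ b ^ k) × (∀ j → j < k → b ^ j < n)

{-# OPTIONS --safe #-}
module Submission where

-- f(i) − f(j) = (i − j)(d(i + j) − 1), and the second factor is ≡ −1 modulo p since p ∣ d.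
-- So if p^k divides f(i) − f(j) it divides j − i, impossible for 1 ≤ i < j ≤ n ≤ p^k.
-- Hence p^k separates f(1), …, f(n), and the least separating modulus, found by a
-- decidable search, is at most p^k; only n ≤ p^k is used of k = ⌈log_p n⌉.

open import Defs
open import Data.Nat using (ℕ; _^_; _≤_)
open import Data.Nat.Primality using (Prime)
open import Data.Product using (Σ; _×_)

open import Data.Nat as ℕ using (zero; suc; _<_; _∸_; s≤s)
open import Data.Nat.Properties
open import Data.Nat.Divisibility as ℕ∣ using (divides)
open import Data.Nat.Induction using (<-rec)
open import Data.Nat.Primality using (euclidsLemma; prime⇒nonZero; prime⇒nonTrivial)
open import Data.Integer as ℤ using (ℤ; +_; ∣_∣; _⊖_)
import Data.Integer.Properties as ℤ
open import Data.Integer.Tactic.RingSolver renaming (solve-∀ to ℤ-solve-∀)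
open import Data.Nat.Tactic.RingSolver renaming (solve-∀ to ℕ-solve-∀)
open import Data.Product using (∃; _,_)
open import Data.Sum using (inj₁; inj₂)
open import Relation.Nullary using (¬_; Dec; yes; no; contradiction)
open import Relation.Nullary.Decidable using (_→-dec_; _×-dec_; ¬?; map′)
open import Relation.Unary using (Pred; Decidable)
open import Relation.Binary.PropositionalEquality

module _ {ℓ} {P : Pred ℕ ℓ} (P? : Decidable P) where

  MinimalBelow : ℕ → Set ℓ
  MinimalBelow n = P n → ∃ λ m → m ≤ n × P m × (∀ {k} → k < m → ¬ P k)

  minimal : ∀ n → MinimalBelow n
  minimal = <-rec MinimalBelow search
    where
    search : ∀ n → (∀ {m} → m < n → MinimalBelow m) → MinimalBelow n
    search n below Pn with anyUpTo? P? n
    ... | yes (m , m<n , Pm) with below m<n Pm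
    ...   | l , l≤m , Pl , least = l , ≤-trans l≤m (<⇒≤ m<n) , Pl , least
    search n below Pn | no none = n , ≤-refl , Pn , λ k<n Pk → none (_ , k<n , Pk)

distinctMod? : ∀ f n m → Dec (DistinctMod f n m)
distinctMod? f n m =
  map′ (λ h i j 1≤i i<j j≤n → h (s≤s j≤n) i<j 1≤i)
       (λ h {j} j<1+n {i} i<j 1≤i → h i j 1≤i i<j (≤-pred j<1+n))
       (allUpTo? (λ j → allUpTo? (λ i → (1 ℕ.≤? i) →-dec ¬? (m ℕ∣.∣? ∣ f (+ i) ℤ.- f (+ j) ∣)) j)
                 (suc n))

fPoly-sub : ∀ d x y → fPoly d x ℤ.- fPoly d y ≡ (x ℤ.- y) ℤ.* (+ d ℤ.* (x ℤ.+ y) ℤ.- + 1)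
fPoly-sub d x y = factor (+ d) x y
  where
  factor : ∀ d x y → x ℤ.* (d ℤ.* x ℤ.- + 1) ℤ.- y ℤ.* (d ℤ.* y ℤ.- + 1)
                     ≡ (x ℤ.- y) ℤ.* (d ℤ.* (x ℤ.+ y) ℤ.- + 1)
  factor = ℤ-solve-∀

∣fPoly-sub∣ : ∀ d {i j} → i ≤ j → 1 ≤ d ℕ.* (i ℕ.+ j) →
              ∣ fPoly d (+ i) ℤ.- fPoly d (+ j) ∣ ≡ (j ∸ i) ℕ.* (d ℕ.* (i ℕ.+ j) ∸ 1)
∣fPoly-sub∣ d {i} {j} i≤j 1≤d[i+j] = begin
  ∣ fPoly d (+ i) ℤ.- fPoly d (+ j) ∣
    ≡⟨ cong ∣_∣ (fPoly-sub d (+ i) (+ j)) ⟩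
  ∣ (+ i ℤ.- + j) ℤ.* (+ d ℤ.* (+ i ℤ.+ + j) ℤ.- + 1) ∣
    ≡⟨ ℤ.abs-* (+ i ℤ.- + j) _ ⟩
  ∣ + i ℤ.- + j ∣ ℕ.* ∣ + d ℤ.* (+ i ℤ.+ + j) ℤ.- + 1 ∣
    ≡⟨ cong₂ ℕ._*_ ∣i-j∣ ∣d[i+j]-1∣ ⟩
  (j ∸ i) ℕ.* (d ℕ.* (i ℕ.+ j) ∸ 1) ∎
  where
  open ≡-Reasoning
  ∣i-j∣ : ∣ + i ℤ.- + j ∣ ≡ j ∸ i
  ∣i-j∣ = trans (cong ∣_∣ (ℤ.m-n≡m⊖n i j)) (ℤ.∣⊖∣-≤ i≤j)
  ∣d[i+j]-1∣ : ∣ + d ℤ.* (+ i ℤ.+ + j) ℤ.- + 1 ∣ ≡ d ℕ.* (i ℕ.+ j) ∸ 1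
  ∣d[i+j]-1∣ = begin
    ∣ + d ℤ.* (+ i ℤ.+ + j) ℤ.- + 1 ∣
      ≡⟨ cong (λ z → ∣ + d ℤ.* z ℤ.- + 1 ∣) (sym (ℤ.pos-+ i j)) ⟩
    ∣ + d ℤ.* + (i ℕ.+ j) ℤ.- + 1 ∣
      ≡⟨ cong (λ z → ∣ z ℤ.- + 1 ∣) (sym (ℤ.pos-* d (i ℕ.+ j))) ⟩
    ∣ (d ℕ.* (i ℕ.+ j)) ⊖ 1 ∣
      ≡⟨ cong ∣_∣ (ℤ.⊖-≥ 1≤d[i+j]) ⟩
    d ℕ.* (i ℕ.+ j) ∸ 1 ∎

∣⇒∤∸1 : ∀ {d m} → 1 < d → d ℕ∣.∣ m → 1 ≤ m → ¬ (d ℕ∣.∣ m ∸ 1)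
∣⇒∤∸1 {d} {m} 1<d d∣m 1≤m d∣m∸1 = <-irrefl (sym (ℕ∣.∣1⇒≡1 d∣1)) 1<d
  where
  d∣1 : d ℕ∣.∣ 1
  d∣1 = ℕ∣.∣m+n∣m⇒∣n (subst (d ℕ∣.∣_) (sym (m∸n+n≡m 1≤m)) d∣m) d∣m∸1

m∣m^n : ∀ m {n} → 1 ≤ n → m ℕ∣.∣ m ^ n
m∣m^n m {suc n} _ = ℕ∣.m∣m*n (m ^ n)

^∣-cancelʳ : ∀ {p n} → Prime p → ¬ (p ℕ∣.∣ n) → ∀ k {m} → p ^ k ℕ∣.∣ m ℕ.* n → p ^ k ℕ∣.∣ m
^∣-cancelʳ pp p∤n zero {m} _ = ℕ∣.1∣ m
^∣-cancelʳ {p} {n} pp p∤n (suc k) {m} pᵏ⁺¹∣mn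
  with euclidsLemma m n pp (ℕ∣.∣-trans (ℕ∣.m∣m*n (p ^ k)) pᵏ⁺¹∣mn)
... | inj₂ p∣n = contradiction p∣n p∤n
... | inj₁ (divides q refl) =
  subst (p ^ suc k ℕ∣.∣_) (*-comm p q)
        (ℕ∣.*-monoʳ-∣ p (^∣-cancelʳ pp p∤n k (ℕ∣.*-cancelˡ-∣ p {{prime⇒nonZero pp}} pᵏ⁺¹∣pqn)))
  where
  rearrange : ∀ a b c → a ℕ.* b ℕ.* c ≡ b ℕ.* (a ℕ.* c)
  rearrange = ℕ-solve-∀
  pᵏ⁺¹∣pqn : p ^ suc k ℕ∣.∣ p ℕ.* (q ℕ.* n)
  pᵏ⁺¹∣pqn = subst (p ^ suc k ℕ∣.∣_) (rearrange q p n) pᵏ⁺¹∣mn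

distinctMod-prime^ : ∀ {p d} → Prime p → p ℕ∣.∣ d → 1 ≤ d →
                     ∀ n k → n ≤ p ^ k → DistinctMod (fPoly d) n (p ^ k)
distinctMod-prime^ {p} {d} pp p∣d 1≤d n k n≤pᵏ i j 1≤i i<j j≤n pᵏ∣diff =
  <-irrefl refl (<-≤-trans j∸i<pᵏ (ℕ∣.∣⇒≤ {{ℕ.>-nonZero (m<n⇒0<n∸m i<j)}} pᵏ∣j∸i))
  where
  1≤d[i+j] : 1 ≤ d ℕ.* (i ℕ.+ j)
  1≤d[i+j] = *-mono-≤ 1≤d (≤-trans 1≤i (m≤m+n i j))
  p∤d[i+j]∸1 : ¬ (p ℕ∣.∣ d ℕ.* (i ℕ.+ j) ∸ 1)
  p∤d[i+j]∸1 = ∣⇒∤∸1 (ℕ.nonTrivial⇒n>1 p {{prime⇒nonTrivial pp}})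
                     (ℕ∣.∣-trans p∣d (ℕ∣.m∣m*n (i ℕ.+ j))) 1≤d[i+j]
  pᵏ∣j∸i : p ^ k ℕ∣.∣ j ∸ i
  pᵏ∣j∸i = ^∣-cancelʳ pp p∤d[i+j]∸1 k
             (subst (p ^ k ℕ∣.∣_) (∣fPoly-sub∣ d (<⇒≤ i<j) 1≤d[i+j]) pᵏ∣diff)
  j∸i<pᵏ : j ∸ i < p ^ k
  j∸i<pᵏ = <-≤-trans (∸-monoʳ-< 1≤i (<⇒≤ i<j)) (≤-trans j≤n n≤pᵏ)

lemma1 : (p r : ℕ) → Prime p → 1 ≤ r → (n : ℕ) → 1 ≤ n → (k : ℕ) → IsCeilLog p n k
         → Σ ℕ (λ D → IsDiscriminator (fPoly (p ^ r)) n D × D ≤ p ^ k)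
lemma1 p r pp 1≤r n _ k (n≤pᵏ , _)
  with minimal (λ m → (1 ℕ.≤? m) ×-dec distinctMod? (fPoly (p ^ r)) n m) (p ^ k)
               (m^n>0 p {{prime⇒nonZero pp}} k ,
                distinctMod-prime^ pp (m∣m^n p 1≤r) (m^n>0 p {{prime⇒nonZero pp}} r) n k n≤pᵏ)
... | D , D≤pᵏ , (1≤D , distinct) , below =
  D , (1≤D , distinct , λ m 1≤m m<D dm → below m<D (1≤m , dm)) , D≤pᵏ
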